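{- Let $X$ be a countably infinite set. Then the topological spaces $\mathbf{AF}^X_{weak}$ and $\mathbf{LF}^X_{str}$ are both homeomorphic to the Baire space $\mathbb{N}^{\mathbb{N}}$ (the product of countably many copies of the discrete space $\mathbb{N}$).
   Context: For a set $X$, a quiver on $X$ is a function $Q:X\times X\to\mathbb{Z}$ with $Q(x,y)=-Q(y,x)$ for all $x,y\in X$ ($Q(x,y)$ is the signed number of arrows from $x$ to $y$). $\mathbf{AF}^X$ denotes the set of all quivers on $X$. $Q$ is locally finite if $\sum_{y\in X}|Q(x,y)|<\infty$ for every $x\in X$; $\mathbf{LF}^X\subseteq\mathbf{AF}^X$ is the set of locally finite quivers. For $V\subseteq X$, the restriction $\rho_V(Q)$ is the quiver on $X$ with $\rho_V(Q)(x,y)=Q(x,y)$ if $x,y\in V$ and $0$ otherwise; the overfill $\lambda_V(Q)$ is the quiver on $X$ with $\lambda_V(Q)(x,y)=Q(x,y)$ if $x\in V$ or $y\in V$, and $0$ otherwise. For $Q\in\mathbf{AF}^X$ and finite $V\subseteq X$ let $U_{Q,V}=\{Q'\in\mathbf{AF}^X:\rho_V(Q')=\rho_V(Q)\}$ and $W_{Q,V}=\{Q'\in\mathbf{AF}^X:\lambda_V(Q')=\lambda_V(Q)\}$. The weak topology on $\mathbf{AF}^X$ is the topology with basis $\{U_{Q,V}\}$, the strong topology is the one with basis $\{W_{Q,V}\}$; $\mathbf{AF}^X_{weak}$, $\mathbf{AF}^X_{str}$ denote these spaces, and $\mathbf{LF}^X_{str}$ denotes $\mathbf{LF}^X$ with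 the subspace topology from $\mathbf{AF}^X_{str}$. $\mathbb{N}$ denotes the positive integers. -}

module Defs where

open import Level using (0ℓ)
open import Data.Nat using (ℕ; _<_)
open import Data.Integer using (ℤ; -_; 0ℤ)
open import Data.List using (List)
open import Data.List.Membership.Propositional using (_∈_; _∉_)
open import Data.Product using (Σ; _×_; _,_; proj₁)
open import Data.Sum using (_⊎_)
open import Relation.Binary.PropositionalEquality using (_≡_)

record BasisSpace : Set₁ where
  field
    Carrier : Set
    _≈_     : Carrier → Carrier → Set
    Index   : Set
    _∈B_    : Carrier → Index → Set

module _ (S : BasisSpace) where
  open BasisSpace S
  IsOpen : (Carrier → Set) → Set
  IsOpen U = ∀ p → U p → Σ Index λ i → (p ∈B i) × (∀ q → q ∈B i → U q)

Continuous : (S T : BasisSpace) → (BasisSpace.Carrier S → BasisSpace.Carrier T) → Set₁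
Continuous S T f = ∀ (U : BasisSpace.Carrier T → Set) → IsOpen T U → IsOpen S (λ p → U (f p))

record Homeomorphism (S T : BasisSpace) : Set₁ where
  module S = BasisSpace S
  module T = BasisSpace T
  field
    to        : S.Carrier → T.Carrier
    from      : T.Carrier → S.Carrier
    to-cong   : ∀ {p q} → p S.≈ q → to p T.≈ to q
    from-cong : ∀ {p q} → p T.≈ q → from p S.≈ from q
    from-to   : ∀ p → from (to p) S.≈ p
    to-from   : ∀ q → to (from q) T.≈ q
    to-cont   : Continuous S T to
    from-cont : Continuous T S from

Baire : BasisSpace
Baire = record
  { Carrier = ℕ → ℕ
  ; _≈_     = λ s t → ∀ i → s i ≡ t i
  ; Index   = (ℕ → ℕ) × ℕ
  ; _∈B_    = λ t (s , n) → ∀ i → i < n → t i ≡ s i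
  }

Quiver : Set → Set
Quiver X = Σ (X → X → ℤ) λ Q → ∀ x y → Q x y ≡ - Q y x

_≈Q_ : {X : Set} → Quiver X → Quiver X → Set
Q ≈Q Q' = ∀ x y → proj₁ Q x y ≡ proj₁ Q' x y

-- Locally finite: each row Q(x,-) has finite support (for integer
-- values this is exactly  Σ_y |Q(x,y)| < ∞).
LocallyFinite : {X : Set} → Quiver X → Set
LocallyFinite {X} Q = ∀ x → Σ (List X) λ S → ∀ y → y ∉ S → proj₁ Q x y ≡ 0ℤ

LFQuiver : Set → Set
LFQuiver X = Σ (Quiver X) LocallyFinite

RestrEq : {X : Set} → List X → Quiver X → Quiver X → Set
RestrEq V Q Q' = ∀ x y → x ∈ V → y ∈ V → proj₁ Q x y ≡ proj₁ Q' x y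

OverfillEq : {X : Set} → List X → Quiver X → Quiver X → Set
OverfillEq V Q Q' = ∀ x y → (x ∈ V ⊎ y ∈ V) → proj₁ Q x y ≡ proj₁ Q' x y

AFweak : Set → BasisSpace
AFweak X = record
  { Carrier = Quiver X
  ; _≈_     = _≈Q_
  ; Index   = Quiver X × List X
  ; _∈B_    = λ Q' (Q , V) → RestrEq V Q' Q
  }

-- LF^X with the subspace topology of the strong topology: basis
-- W_{Q,V} ∩ LF^X for Q ∈ AF^X and finite V, W_{Q,V} = {Q' | λ_V(Q') = λ_V(Q)}.
LFstr : Set → BasisSpace
LFstr X = record
  { Carrier = LFQuiver X
  ; _≈_     = λ P P' → proj₁ P ≈Q proj₁ P'
  ; Index   = Quiver X × List X
  ; _∈B_    = λ P (Q , V) → OverfillEq V (proj₁ P) Q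
  }

-- Enumerate X as ℕ. An antisymmetric Q is determined by its entries above the
-- diagonal, Q(i, i+1+d), and these can be prescribed freely; coding ℤ by ℕ, a
-- quiver is thus the same as an array ℕ → ℕ → ℕ. For the weak topology, whose
-- basic opens fix finitely many entries, Cantor pairing flattens the array into
-- a point of ℕ^ℕ. A quiver is locally finite iff every row of the array has
-- finite support; the basic opens of the strong topology fix finitely many whole
-- rows, so coding each finitely supported row by a single natural number gives
-- a point of ℕ^ℕ again.
module Submission where

open import Defs
open import Data.Nat using (ℕ; zero; suc; _+_; _∸_; _≤_; _<_; z≤n; s≤s; z<s; _<?_)
open import Data.Nat.Properties
open import Data.Integer using (ℤ; +_; -[1+_]; -_; 0ℤ)
open import Data.Integer.Properties using (neg-involutive)
open import Data.Product using (_×_; Σ; _,_; proj₁; proj₂; uncurry)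
open import Data.Sum using (_⊎_; inj₁; inj₂; swap)
open import Data.List using (List; map; upTo; cartesianProduct)
open import Data.List.Membership.Propositional using (_∈_; _∉_)
open import Data.List.Membership.Propositional.Properties
  using (∈-map⁺; ∈-upTo⁺; ∈-cartesianProductWith⁺)
open import Data.List.Extrema.Nat using (max; xs≤max)
import Data.List.Relation.Unary.All as All
open import Relation.Nullary using (yes; no; Dec; contradiction)
open import Relation.Binary using (tri<; tri≈; tri>)
open import Relation.Binary.PropositionalEquality
open import Function.Bundles using (_↔_; Inverse)

module _ (S T : BasisSpace) where
  private
    module S = BasisSpace S
    module T = BasisSpace T

  continuous-by-basis : (f : S.Carrier → T.Carrier) →
    (∀ p j → f p T.∈B j → Σ S.Index λ i → p S.∈B i × (∀ q → q S.∈B i → f q T.∈B j)) →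
    Continuous S T f
  continuous-by-basis f basic U U-open p Ufp with U-open (f p) Ufp
  ... | j , fp∈j , j⊆U with basic p j fp∈j
  ...   | i , p∈i , i⊆f⁻¹j = i , p∈i , λ q q∈i → j⊆U (f q) (i⊆f⁻¹j q q∈i)

module _ (S : BasisSpace) where
  open BasisSpace S

  continuous-to-Baire : (f : Carrier → ℕ → ℕ) →
    (∀ p n → Σ Index λ i → p ∈B i × (∀ q → q ∈B i → ∀ k → k < n → f q k ≡ f p k)) →
    Continuous S Baire f
  continuous-to-Baire f prefix-fixed = continuous-by-basis S Baire f λ p (s , n) fp∈sn →
    let i , p∈i , fixed = prefix-fixed p n
    in i , p∈i , λ q q∈i k k<n → trans (fixed q q∈i k k<n) (fp∈sn k k<n)

  continuous-from-Baire : (g : (ℕ → ℕ) → Carrier) →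
    (∀ s i → g s ∈B i → Σ ℕ λ n → ∀ t → (∀ k → k < n → t k ≡ s k) → g t ∈B i) →
    Continuous Baire S g
  continuous-from-Baire g prefix-suffices = continuous-by-basis Baire S g λ s i gs∈i →
    let n , suffices = prefix-suffices s i gs∈i
    in (s , n) , (λ _ _ → refl) , suffices

grow : ℤ → ℤ
grow (+ n)    = + suc n
grow -[1+ n ] = -[1+ suc n ]

zigzag : ℤ → ℕ
zigzag (+ zero)       = 0
zigzag (+ suc n)      = suc (suc (zigzag (+ n)))
zigzag -[1+ zero ]    = 1
zigzag -[1+ suc n ]   = suc (suc (zigzag -[1+ n ]))

unzigzag : ℕ → ℤ
unzigzag zero          = + 0
unzigzag (suc zero)    = -[1+ 0 ]
unzigzag (suc (suc n)) = grow (unzigzag n)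

zigzag-grow : ∀ z → zigzag (grow z) ≡ suc (suc (zigzag z))
zigzag-grow (+ n)    = refl
zigzag-grow -[1+ n ] = refl

unzigzag-zigzag : ∀ z → unzigzag (zigzag z) ≡ z
unzigzag-zigzag (+ zero)     = refl
unzigzag-zigzag (+ suc n)    = cong grow (unzigzag-zigzag (+ n))
unzigzag-zigzag -[1+ zero ]  = refl
unzigzag-zigzag -[1+ suc n ] = cong grow (unzigzag-zigzag -[1+ n ])

zigzag-unzigzag : ∀ n → zigzag (unzigzag n) ≡ n
zigzag-unzigzag zero          = refl
zigzag-unzigzag (suc zero)    = refl
zigzag-unzigzag (suc (suc n)) =
  trans (zigzag-grow (unzigzag n)) (cong (λ m → suc (suc m)) (zigzag-unzigzag n))

triangle : ℕ → ℕ
triangle zero    = 0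
triangle (suc n) = suc n + triangle n

pair : ℕ × ℕ → ℕ
pair (a , b) = b + triangle (a + b)

next : ℕ × ℕ → ℕ × ℕ
next (suc a , b) = a , suc b
next (zero , b)  = suc b , 0

unpair : ℕ → ℕ × ℕ
unpair zero    = 0 , 0
unpair (suc n) = next (unpair n)

pair-next : ∀ p → pair (next p) ≡ suc (pair p)
pair-next (suc a , b) = cong (λ s → suc b + triangle s) (+-suc a b)
pair-next (zero , b)  = cong triangle (+-identityʳ (suc b))

pair-unpair : ∀ n → pair (unpair n) ≡ n
pair-unpair zero    = refl
pair-unpair (suc n) = trans (pair-next (unpair n)) (cong suc (pair-unpair n))

-- Every pair other than (0, 0) is the successor of another one.
unpair-pair≡ : ∀ n p → pair p ≡ n → unpair n ≡ p
unpair-pair≡ zero    (zero , zero)  _ = refl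
unpair-pair≡ zero    (a , suc b)    ()
unpair-pair≡ zero    (suc a , zero) ()
unpair-pair≡ (suc n) (zero , zero)  ()
unpair-pair≡ (suc n) (a , suc b)    eq =
  cong next (unpair-pair≡ n (suc a , b) (suc-injective (trans (sym (pair-next (suc a , b))) eq)))
unpair-pair≡ (suc n) (suc a , zero) eq =
  cong next (unpair-pair≡ n (zero , a) (suc-injective (trans (sym (pair-next (zero , a))) eq)))

unpair-pair : ∀ p → unpair (pair p) ≡ p
unpair-pair p = unpair-pair≡ (pair p) p refl

n≤triangle : ∀ n → n ≤ triangle n
n≤triangle zero    = z≤n
n≤triangle (suc n) = m≤m+n (suc n) (triangle n)

a+b≤pair : ∀ a b → a + b ≤ pair (a , b)
a+b≤pair a b = ≤-trans (n≤triangle (a + b)) (m≤n+m (triangle (a + b)) b)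

proj₂-next≤pair : ∀ p → proj₂ (next p) ≤ pair p
proj₂-next≤pair (suc a , b) = m<m+n b z<s
proj₂-next≤pair (zero , b)  = z≤n

-- Codes of finitely supported sequences: n codes the sequence whose head is
-- the first component of unpair n and whose tail is coded by the second.

VanishesFrom : (ℕ → ℕ) → ℕ → Set
VanishesFrom f B = ∀ d → B ≤ d → f d ≡ 0

tail : ℕ → ℕ
tail n = proj₂ (unpair n)

tail≤ : ∀ n {B} → n ≤ suc B → tail n ≤ B
tail≤ zero    _         = z≤n
tail≤ (suc n) (s≤s n≤B) =
  ≤-trans (proj₂-next≤pair (unpair n)) (≤-trans (≤-reflexive (pair-unpair n)) n≤B)

decodeSeq : ℕ → ℕ → ℕ
decodeSeq n zero    = proj₁ (unpair n)
decodeSeq n (suc d) = decodeSeq (tail n) d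

prefixCode : (ℕ → ℕ) → ℕ → ℕ
prefixCode f zero    = 0
prefixCode f (suc B) = pair (f 0 , prefixCode (λ d → f (suc d)) B)

decodeSeq-vanishes : ∀ n → VanishesFrom (decodeSeq n) n
decodeSeq-vanishes zero    zero    _   = refl
decodeSeq-vanishes n       (suc d) n≤d = decodeSeq-vanishes (tail n) d (tail≤ n n≤d)

prefixCode-cong : ∀ {f g} → (∀ d → f d ≡ g d) → ∀ B → prefixCode f B ≡ prefixCode g B
prefixCode-cong f≗g zero    = refl
prefixCode-cong f≗g (suc B) =
  cong₂ (λ h c → pair (h , c)) (f≗g 0) (prefixCode-cong (λ d → f≗g (suc d)) B)

prefixCode-decodeSeq : ∀ B n → n ≤ B → prefixCode (decodeSeq n) B ≡ n
prefixCode-decodeSeq zero    zero _   = refl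
prefixCode-decodeSeq (suc B) n    n≤B =
  trans (cong (λ c → pair (proj₁ (unpair n) , c)) (prefixCode-decodeSeq B (tail n) (tail≤ n n≤B)))
        (pair-unpair n)

decodeSeq-prefixCode : ∀ B {f} → VanishesFrom f B → ∀ d → decodeSeq (prefixCode f B) d ≡ f d
decodeSeq-prefixCode zero    vanishes d       = trans (decodeSeq-vanishes 0 d z≤n) (sym (vanishes d z≤n))
decodeSeq-prefixCode (suc B) {f} _ zero       =
  cong proj₁ (unpair-pair (f 0 , prefixCode (λ d → f (suc d)) B))
decodeSeq-prefixCode (suc B) {f} vanishes (suc d) =
  trans (cong (λ p → decodeSeq (proj₂ p) d) (unpair-pair (f 0 , prefixCode (λ d → f (suc d)) B)))
        (decodeSeq-prefixCode B (λ d B≤d → vanishes (suc d) (s≤s B≤d)) d)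

decodeSeq-injective : ∀ {m n} → (∀ d → decodeSeq m d ≡ decodeSeq n d) → m ≡ n
decodeSeq-injective {m} {n} same = begin
  m                                ≡⟨ prefixCode-decodeSeq (m + n) m (m≤m+n m n) ⟨
  prefixCode (decodeSeq m) (m + n) ≡⟨ prefixCode-cong same (m + n) ⟩
  prefixCode (decodeSeq n) (m + n) ≡⟨ prefixCode-decodeSeq (m + n) n (m≤n+m n m) ⟩
  n                                ∎
  where open ≡-Reasoning

prefixCode-unique : ∀ {f g} B C → (∀ d → f d ≡ g d) →
  VanishesFrom f B → VanishesFrom g C → prefixCode f B ≡ prefixCode g C
prefixCode-unique B C f≗g f-vanishes g-vanishes = decodeSeq-injective λ d →
  trans (decodeSeq-prefixCode B f-vanishes d)
        (trans (f≗g d) (sym (decodeSeq-prefixCode C g-vanishes d)))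

skewAt : (ℕ → ℕ → ℤ) → (i j : ℕ) → Dec (i < j) → Dec (j < i) → ℤ
skewAt h i j (yes _) _       = h i (j ∸ suc i)
skewAt h i j (no _)  (yes _) = - h j (i ∸ suc j)
skewAt h i j (no _)  (no _)  = 0ℤ

skew : (ℕ → ℕ → ℤ) → ℕ → ℕ → ℤ
skew h i j = skewAt h i j (i <? j) (j <? i)

skew-antisym : ∀ h i j → skew h i j ≡ - skew h j i
skew-antisym h i j with i <? j | j <? i
... | yes i<j | yes j<i = contradiction j<i (<-asym i<j)
... | yes _   | no _    = sym (neg-involutive _)
... | no _    | yes _   = refl
... | no _    | no _    = refl

skew-< : ∀ h {i j} → i < j → skew h i j ≡ h i (j ∸ suc i)
skew-< h {i} {j} i<j with i <? j
... | yes _   = refl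
... | no i≮j  = contradiction i<j i≮j

skew-> : ∀ h {i j} → j < i → skew h i j ≡ - h j (i ∸ suc j)
skew-> h {i} {j} j<i with i <? j | j <? i
... | yes i<j | _      = contradiction j<i (<-asym i<j)
... | no _    | yes _  = refl
... | no _    | no j≮i = contradiction j<i j≮i

skew-diagonal : ∀ h i → skew h i i ≡ 0ℤ
skew-diagonal h i with i <? i
... | yes i<i = contradiction i<i (<-irrefl refl)
... | no _    = refl

skew-local : ∀ h h′ i j → (i < j → h i (j ∸ suc i) ≡ h′ i (j ∸ suc i)) →
  (j < i → h j (i ∸ suc j) ≡ h′ j (i ∸ suc j)) → skew h i j ≡ skew h′ i j
skew-local h h′ i j upper lower with i <? j | j <? i
... | yes i<j | _      = upper i<j
... | no _    | yes j<i = cong -_ (lower j<i)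
... | no _    | no _    = refl

skew-cong : ∀ {h h′} → (∀ i d → h i d ≡ h′ i d) → ∀ i j → skew h i j ≡ skew h′ i j
skew-cong {h} {h′} h≗h′ i j = skew-local h h′ i j (λ _ → h≗h′ _ _) (λ _ → h≗h′ _ _)

i+[1+j∸1+i]≡j : ∀ {i j} → i < j → i + suc (j ∸ suc i) ≡ j
i+[1+j∸1+i]≡j {i} i<j = trans (+-suc i _) (m+[n∸m]≡n i<j)

skew-upper : ∀ h i d → skew h i (i + suc d) ≡ h i d
skew-upper h i d = trans (skew-< h i<i+1+d) (cong (h i) i+1+d∸1+i≡d)
  where
  i<i+1+d : i < i + suc d
  i<i+1+d = m<m+n i z<s
  i+1+d∸1+i≡d : i + suc d ∸ suc i ≡ d
  i+1+d∸1+i≡d = trans (cong (_∸ suc i) (+-suc i d)) (m+n∸m≡n (suc i) d)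

x≡-x⇒x≡0 : ∀ z → z ≡ - z → z ≡ 0ℤ
x≡-x⇒x≡0 (+ zero)  _ = refl
x≡-x⇒x≡0 (+ suc n) ()
x≡-x⇒x≡0 -[1+ n ]  ()

skew-of-upper : ∀ (A : ℕ → ℕ → ℤ) → (∀ i j → A i j ≡ - A j i) →
  ∀ i j → skew (λ i d → A i (i + suc d)) i j ≡ A i j
skew-of-upper A antisym i j with <-cmp i j
... | tri< i<j _ _ = trans (skew-< _ i<j) (cong (A i) (i+[1+j∸1+i]≡j i<j))
... | tri> _ _ j<i =
  trans (skew-> _ j<i) (trans (cong -_ (cong (A j) (i+[1+j∸1+i]≡j j<i))) (sym (antisym i j)))
... | tri≈ _ refl _ = trans (skew-diagonal _ i) (sym (x≡-x⇒x≡0 (A i i) (antisym i i)))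

bound : {A : Set} → (A → ℕ) → List A → ℕ
bound f xs = suc (max 0 (map f xs))

∈⇒<bound : ∀ {A : Set} (f : A → ℕ) {x xs} → x ∈ xs → f x < bound f xs
∈⇒<bound f {xs = xs} x∈xs = s≤s (All.lookup (xs≤max 0 (map f xs)) (∈-map⁺ f x∈xs))

module _ {X : Set} (enum : X ↔ ℕ) where
  private
    index : X → ℕ
    index = Inverse.to enum

    point : ℕ → X
    point = Inverse.from enum

    index-point : ∀ n → index (point n) ≡ n
    index-point = Inverse.strictlyInverseˡ enum

    point-index : ∀ x → point (index x) ≡ x
    point-index = Inverse.strictlyInverseʳ enum

  upper : Quiver X → ℕ → ℕ → ℕ
  upper (Q , _) i d = zigzag (Q (point i) (point (i + suc d)))

  fromUpperℤ : (ℕ → ℕ → ℕ) → ℕ → ℕ → ℤ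
  fromUpperℤ h i d = unzigzag (h i d)

  fromUpper : (ℕ → ℕ → ℕ) → Quiver X
  fromUpper h = (λ x y → skew (fromUpperℤ h) (index x) (index y))
              , (λ x y → skew-antisym (fromUpperℤ h) (index x) (index y))

  upper-cong : ∀ {Q Q′} → Q ≈Q Q′ → ∀ i d → upper Q i d ≡ upper Q′ i d
  upper-cong Q≈Q′ i d = cong zigzag (Q≈Q′ _ _)

  fromUpper-cong : ∀ {h h′} → (∀ i d → h i d ≡ h′ i d) → fromUpper h ≈Q fromUpper h′
  fromUpper-cong h≗h′ x y = skew-cong (λ i d → cong unzigzag (h≗h′ i d)) (index x) (index y)

  upper-fromUpper : ∀ h i d → upper (fromUpper h) i d ≡ h i d
  upper-fromUpper h i d = begin
    zigzag (skew (fromUpperℤ h) (index (point i)) (index (point (i + suc d))))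
      ≡⟨ cong zigzag (cong₂ (skew (fromUpperℤ h)) (index-point i) (index-point (i + suc d))) ⟩
    zigzag (skew (fromUpperℤ h) i (i + suc d))
      ≡⟨ cong zigzag (skew-upper (fromUpperℤ h) i d) ⟩
    zigzag (unzigzag (h i d))
      ≡⟨ zigzag-unzigzag (h i d) ⟩
    h i d
      ∎
    where open ≡-Reasoning

  fromUpper-upper : ∀ {h} Q → (∀ i d → h i d ≡ upper Q i d) → fromUpper h ≈Q Q
  fromUpper-upper {h} Q@(q , antisym) h≗upper x y = begin
    skew (fromUpperℤ h) (index x) (index y)
      ≡⟨ skew-cong entry (index x) (index y) ⟩
    skew (λ i d → A i (i + suc d)) (index x) (index y)
      ≡⟨ skew-of-upper A (λ i j → antisym (point i) (point j)) (index x) (index y) ⟩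
    q (point (index x)) (point (index y))
      ≡⟨ cong₂ q (point-index x) (point-index y) ⟩
    q x y
      ∎
    where
    open ≡-Reasoning
    A : ℕ → ℕ → ℤ
    A i j = q (point i) (point j)
    entry : ∀ i d → fromUpperℤ h i d ≡ A i (i + suc d)
    entry i d = trans (cong unzigzag (h≗upper i d)) (unzigzag-zigzag _)

  ptsBelow : ℕ → List X
  ptsBelow n = map point (upTo n)

  point∈ptsBelow : ∀ {k n} → k < n → point k ∈ ptsBelow n
  point∈ptsBelow k<n = ∈-map⁺ point (∈-upTo⁺ k<n)

  ∉ptsBelow⇒≥ : ∀ {y n} → y ∉ ptsBelow n → n ≤ index y
  ∉ptsBelow⇒≥ {y} y∉ = ≮⇒≥ λ y<n → y∉ (subst (_∈ _) (point-index y) (point∈ptsBelow y<n))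

  fromUpper-locallyFinite : ∀ {h} (B : ℕ → ℕ) → (∀ i → VanishesFrom (h i) (B i)) →
    LocallyFinite (fromUpper h)
  fromUpper-locallyFinite {h} B vanishes x = ptsBelow (suc (i + B i)) , beyond
    where
    i = index x
    beyond : ∀ y → y ∉ ptsBelow (suc (i + B i)) → skew (fromUpperℤ h) i (index y) ≡ 0ℤ
    beyond y y∉ = trans (skew-< (fromUpperℤ h) i<j) (cong unzigzag (vanishes i _ B≤j∸1+i))
      where
      j = index y
      1+i+B≤j : suc i + B i ≤ j
      1+i+B≤j = ∉ptsBelow⇒≥ y∉
      i<j : i < j
      i<j = m+n≤o⇒m≤o (suc i) 1+i+B≤j
      B≤j∸1+i : B i ≤ j ∸ suc i
      B≤j∸1+i = subst (_≤ j ∸ suc i) (m+n∸m≡n (suc i) (B i)) (∸-monoˡ-≤ (suc i) 1+i+B≤j)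

  AFweak≅Baire : Homeomorphism (AFweak X) Baire
  AFweak≅Baire = record
    { to        = to
    ; from      = from
    ; to-cong   = λ {Q} {Q′} Q≈Q′ k → uncurry (upper-cong {Q} {Q′} Q≈Q′) (unpair k)
    ; from-cong = λ s≗t → fromUpper-cong (λ i d → s≗t _)
    ; from-to   = λ Q → fromUpper-upper Q λ i d → cong (uncurry (upper Q)) (unpair-pair (i , d))
    ; to-from   = to-from
    ; to-cont   = continuous-to-Baire (AFweak X) to to-prefix-fixed
    ; from-cont = continuous-from-Baire (AFweak X) from from-prefix-suffices
    }
    where
    to : Quiver X → ℕ → ℕ
    to Q k = uncurry (upper Q) (unpair k)

    entries : (ℕ → ℕ) → ℕ → ℕ → ℕ
    entries s i d = s (pair (i , d))

    from : (ℕ → ℕ) → Quiver X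
    from s = fromUpper (entries s)

    to-from : ∀ s k → to (from s) k ≡ s k
    to-from s k = trans (upper-fromUpper (entries s) (proj₁ (unpair k)) (proj₂ (unpair k)))
                        (cong s (pair-unpair k))

    to-prefix-fixed : ∀ Q n → Σ (Quiver X × List X) λ (Q₀ , V) → RestrEq V Q Q₀ ×
      (∀ Q′ → RestrEq V Q′ Q₀ → ∀ k → k < n → to Q′ k ≡ to Q k)
    to-prefix-fixed Q n = (Q , ptsBelow (suc n)) , (λ _ _ _ _ → refl) , fixed
      where
      fixed : ∀ Q′ → RestrEq (ptsBelow (suc n)) Q′ Q → ∀ k → k < n → to Q′ k ≡ to Q k
      fixed Q′ Q′≈Q k k<n = cong zigzag (Q′≈Q _ _ (point∈ptsBelow a<1+n) (point∈ptsBelow a+1+b<1+n))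
        where
        a = proj₁ (unpair k)
        b = proj₂ (unpair k)
        a+b≤k : a + b ≤ k
        a+b≤k = subst (a + b ≤_) (pair-unpair k) (a+b≤pair a b)
        a<1+n : a < suc n
        a<1+n = s≤s (≤-trans (m≤m+n a b) (≤-trans a+b≤k (<⇒≤ k<n)))
        a+1+b<1+n : a + suc b < suc n
        a+1+b<1+n = s≤s (subst (_≤ n) (sym (+-suc a b)) (≤-trans (s≤s a+b≤k) k<n))

    code : X × X → ℕ
    code (x , y) = pair (index x , index y ∸ suc (index x))

    from-prefix-suffices : ∀ s QV → RestrEq (proj₂ QV) (from s) (proj₁ QV) →
      Σ ℕ λ n → ∀ t → (∀ k → k < n → t k ≡ s k) → RestrEq (proj₂ QV) (from t) (proj₁ QV)
    from-prefix-suffices s (Q , V) from-s≈Q = n , λ t t≗s x y x∈V y∈V →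
      trans (skew-local (fromUpperℤ (entries t)) (fromUpperℤ (entries s)) (index x) (index y)
              (λ _ → cong unzigzag (t≗s _ (code<n x∈V y∈V)))
              (λ _ → cong unzigzag (t≗s _ (code<n y∈V x∈V))))
            (from-s≈Q x y x∈V y∈V)
      where
      n = bound code (cartesianProduct V V)
      code<n : ∀ {x y} → x ∈ V → y ∈ V → code (x , y) < n
      code<n x∈V y∈V = ∈⇒<bound code (∈-cartesianProductWith⁺ _,_ x∈V y∈V)

  rowBound : LFQuiver X → ℕ → ℕ
  rowBound (_ , lf) i = bound index (proj₁ (lf (point i)))

  row-vanishes : ∀ P i → VanishesFrom (upper (proj₁ P) i) (rowBound P i)
  row-vanishes P@(_ , lf) i d B≤d = cong zigzag (proj₂ (lf (point i)) (point (i + suc d)) ∉support)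
    where
    ∉support : point (i + suc d) ∉ proj₁ (lf (point i))
    ∉support ∈support = <-irrefl refl (≤-<-trans d≤i+1+d (<-≤-trans i+1+d<B B≤d))
      where
      d≤i+1+d : d ≤ i + suc d
      d≤i+1+d = ≤-trans (n≤1+n d) (m≤n+m (suc d) i)
      i+1+d<B : i + suc d < rowBound P i
      i+1+d<B = subst (_< rowBound P i) (index-point (i + suc d)) (∈⇒<bound index ∈support)

  LFstr≅Baire : Homeomorphism (LFstr X) Baire
  LFstr≅Baire = record
    { to        = to
    ; from      = from
    ; to-cong   = λ {P} {P′} P≈P′ i →
        prefixCode-unique _ _ (upper-cong {proj₁ P} {proj₁ P′} P≈P′ i) (row-vanishes P i) (row-vanishes P′ i)
    ; from-cong = λ s≗t → fromUpper-cong (λ i d → cong (λ c → decodeSeq c d) (s≗t i))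
    ; from-to   = λ P → fromUpper-upper (proj₁ P) λ i d →
        decodeSeq-prefixCode (rowBound P i) (row-vanishes P i) d
    ; to-from   = to-from
    ; to-cont   = continuous-to-Baire (LFstr X) to to-prefix-fixed
    ; from-cont = continuous-from-Baire (LFstr X) from from-prefix-suffices
    }
    where
    to : LFQuiver X → ℕ → ℕ
    to P i = prefixCode (upper (proj₁ P) i) (rowBound P i)

    rows : (ℕ → ℕ) → ℕ → ℕ → ℕ
    rows s i = decodeSeq (s i)

    from : (ℕ → ℕ) → LFQuiver X
    from s = fromUpper (rows s) , fromUpper-locallyFinite {rows s} s (λ i → decodeSeq-vanishes (s i))

    to-from : ∀ s i → to (from s) i ≡ s i
    to-from s i = decodeSeq-injective λ d →
      trans (decodeSeq-prefixCode (rowBound (from s) i) (row-vanishes (from s) i) d)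
            (upper-fromUpper (rows s) i d)

    to-prefix-fixed : ∀ P n → Σ (Quiver X × List X) λ (Q₀ , V) → OverfillEq V (proj₁ P) Q₀ ×
      (∀ P′ → OverfillEq V (proj₁ P′) Q₀ → ∀ k → k < n → to P′ k ≡ to P k)
    to-prefix-fixed P n = (proj₁ P , ptsBelow n) , (λ _ _ _ → refl) , λ P′ P′≈P i i<n →
      prefixCode-unique _ _ (λ d → cong zigzag (P′≈P _ _ (inj₁ (point∈ptsBelow i<n))))
                        (row-vanishes P′ i) (row-vanishes P i)

    -- An entry with one endpoint in V lies in the row of its smaller endpoint,
    -- whose index is therefore below the bound of V.
    from-prefix-suffices : ∀ s QV → OverfillEq (proj₂ QV) (proj₁ (from s)) (proj₁ QV) →
      Σ ℕ λ n → ∀ t → (∀ k → k < n → t k ≡ s k) → OverfillEq (proj₂ QV) (proj₁ (from t)) (proj₁ QV)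
    from-prefix-suffices s (Q , V) from-s≈Q = n , λ t t≗s x y x∨y∈V →
      trans (skew-local (fromUpperℤ (rows t)) (fromUpperℤ (rows s)) (index x) (index y)
              (λ x<y → row-fixed t t≗s (smaller-below x∨y∈V x<y) (index y ∸ suc (index x)))
              (λ y<x → row-fixed t t≗s (smaller-below (swap x∨y∈V) y<x) (index x ∸ suc (index y))))
            (from-s≈Q x y x∨y∈V)
      where
      n = bound index V
      row-fixed : ∀ t → (∀ k → k < n → t k ≡ s k) → ∀ {i} → i < n →
        ∀ d → fromUpperℤ (rows t) i d ≡ fromUpperℤ (rows s) i d
      row-fixed t t≗s i<n d = cong (λ c → unzigzag (decodeSeq c d)) (t≗s _ i<n)
      smaller-below : ∀ {x y} → x ∈ V ⊎ y ∈ V → index x < index y → index x < n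
      smaller-below (inj₁ x∈V) _   = ∈⇒<bound index x∈V
      smaller-below (inj₂ y∈V) x<y = <-trans x<y (∈⇒<bound index y∈V)

theorem1p1 : (X : Set) → X ↔ ℕ →
    Homeomorphism (AFweak X) Baire × Homeomorphism (LFstr X) Baire
theorem1p1 X enum = AFweak≅Baire enum , LFstr≅Baire enum
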